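{- $\kappa^s(Q_5;K_{1,5})\ge 3$.
   Context: The $n$-dimensional hypercube $Q_n$ has as vertices all binary strings of length $n$, two strings being adjacent iff they differ in exactly one position. $K_{1,r}$ denotes the star with $r$ leaves. For a graph $G$ and a set $F$ of subgraphs of $G$, $G-F$ denotes the graph obtained from $G$ by deleting all vertices of all members of $F$. For a connected graph $T$, $\kappa^s(G;T)$ is the minimum cardinality of a set $F$ of subgraphs of $G$, each isomorphic to a connected subgraph of $T$, such that $G-F$ is disconnected. -}

module Defs where

open import Data.Nat using (ℕ; zero; suc; _≤_)
open import Data.Bool using (Bool; true; false)
open import Data.Vec using (Vec; []; _∷_)
open import Data.List using (List; length)
open import Data.List.Relation.Unary.Any using (Any)
open import Data.List.Relation.Unary.All using (All)
open import Data.List.Relation.Unary.Unique.Propositional using (Unique)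
open import Data.List.Membership.Propositional using (_∈_)
open import Data.Sum using (_⊎_)
open import Data.Product using (Σ; _×_)
open import Relation.Binary.PropositionalEquality using (_≡_)
open import Relation.Nullary using (¬_)

Vertex : ℕ → Set
Vertex n = Vec Bool n

hamming : ∀ {n} → Vertex n → Vertex n → ℕ
hamming [] [] = zero
hamming (true ∷ xs) (true ∷ ys) = hamming xs ys
hamming (false ∷ xs) (false ∷ ys) = hamming xs ys
hamming (true ∷ xs) (false ∷ ys) = suc (hamming xs ys)
hamming (false ∷ xs) (true ∷ ys) = suc (hamming xs ys)

Adj : ∀ {n} → Vertex n → Vertex n → Set
Adj u v = hamming u v ≡ 1

-- A subgraph of Q_n isomorphic to a connected subgraph of K_{1,r}.
-- The connected subgraphs of K_{1,r} are exactly the stars K_{1,s}, 0 ≤ s ≤ r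
-- (K_{1,0} = K_1, K_{1,1} = K_2). A subgraph of Q_n isomorphic to K_{1,s}
-- consists of a centre vertex together with s distinct vertices adjacent to it
-- (and the s edges joining them to the centre).
record StarSub (n r : ℕ) : Set where
  field
    center    : Vertex n
    leaves    : List (Vertex n)
    distinct  : Unique leaves
    adjacent  : All (Adj center) leaves
    size      : length leaves ≤ r
open StarSub public

InStar : ∀ {n r} → StarSub n r → Vertex n → Set
InStar S v = v ≡ center S ⊎ v ∈ leaves S

Deleted : ∀ {n r} → List (StarSub n r) → Vertex n → Set
Deleted F v = Any (λ S → InStar S v) F

data Reach {n r} (F : List (StarSub n r)) : Vertex n → Vertex n → Set where
  here : ∀ {u} → ¬ Deleted F u → Reach F u u
  step : ∀ {u v w} → ¬ Deleted F u → Adj u v → Reach F v w → Reach F u w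

Disconnected : ∀ {n r} → List (StarSub n r) → Set
Disconnected {n} F =
  Σ (Vertex n) (λ u → Σ (Vertex n) (λ w →
     (¬ Deleted F u) × (¬ Deleted F w) × ¬ Reach F u w))

-- Deleting at most two stars removes only vertices within distance 1 of two
-- centres c₁, c₂, which can be taken distinct from the two survivors to be
-- joined.  In Q₅ every vertex other than c₁ and c₂ has a neighbour at
-- distance at least 2 from both centres, and among those far vertices there is
-- a sink t to which all of them descend greedily: each far vertex other than t
-- has a far neighbour strictly closer to t.  Hence every surviving vertex walks
-- to t.  Both facts about Q₅ are decided by exhaustive computation over all
-- pairs of centres.
module Submission where

open import Defs
open import Data.Bool using (true; false; not)
open import Data.Bool.Properties using (not-¬) renaming (_≟_ to _≟ᵇ_)
open import Data.Fin using (Fin; zero; suc)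
import Data.Fin.Properties as Fin
open import Data.List using (List; []; _∷_; length)
open import Data.List.Relation.Unary.All using (lookup)
open import Data.List.Relation.Unary.Any as Any using ()
open import Data.Nat using (ℕ; zero; suc; _≤_; _<_; _≤?_; _<?_; z≤n; s≤s)
open import Data.Nat.Induction using (<-wellFounded)
open import Data.Nat.Properties using (0≢1+n)
open import Data.Product using (∃; ∃-syntax; ∃₂; _×_; _,_)
open import Data.Sum using (_⊎_; inj₁; inj₂; [_,_])
open import Data.Vec using ([]; _∷_; updateAt; head)
open import Data.Vec.Properties using (≡-dec)
open import Function using (_∘_)
open import Induction.WellFounded using (Acc; acc)
open import Relation.Binary.PropositionalEquality using (_≡_; _≢_; refl; sym; trans; cong; subst)
open import Relation.Nullary using (Dec; yes; no; ¬_; ¬?)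
open import Relation.Nullary.Decidable using (map′; _×-dec_; _⊎-dec_; _→-dec_; toWitness)
open import Relation.Unary using (Decidable)

private variable
  n r : ℕ
  c₁ c₂ t u v w : Vertex n
  F : List (StarSub n r)

_≟_ : (u v : Vertex n) → Dec (u ≡ v)
_≟_ = ≡-dec _≟ᵇ_

all? : {P : Vertex n → Set} → Decidable P → Dec (∀ v → P v)
all? {zero}  P? = map′ (λ p → λ { [] → p }) (λ f → f []) (P? [])
all? {suc n} P? = map′ (λ (f , g) → λ { (true ∷ v) → f v ; (false ∷ v) → g v })
                       (λ h → h ∘ (true ∷_) , h ∘ (false ∷_))
                       (all? (P? ∘ (true ∷_)) ×-dec all? (P? ∘ (false ∷_)))

any? : {P : Vertex n → Set} → Decidable P → Dec (∃ P)
any? {zero}  P? = map′ ([] ,_) (λ { ([] , p) → p }) (P? [])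
any? {suc n} P? = map′ (λ { (inj₁ (v , p)) → true ∷ v , p ; (inj₂ (v , p)) → false ∷ v , p })
                       (λ { (true ∷ v , p) → inj₁ (v , p) ; (false ∷ v , p) → inj₂ (v , p) })
                       (any? (P? ∘ (true ∷_)) ⊎-dec any? (P? ∘ (false ∷_)))

hamming-refl : (v : Vertex n) → hamming v v ≡ 0
hamming-refl []          = refl
hamming-refl (true ∷ v)  = hamming-refl v
hamming-refl (false ∷ v) = hamming-refl v

hamming-sym : (u v : Vertex n) → hamming u v ≡ hamming v u
hamming-sym []          []          = refl
hamming-sym (true ∷ u)  (true ∷ v)  = hamming-sym u v
hamming-sym (true ∷ u)  (false ∷ v) = cong suc (hamming-sym u v)
hamming-sym (false ∷ u) (true ∷ v)  = cong suc (hamming-sym u v)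
hamming-sym (false ∷ u) (false ∷ v) = hamming-sym u v

adj-sym : Adj u v → Adj v u
adj-sym {u = u} {v} = trans (hamming-sym v u)

flip : Fin n → Vertex n → Vertex n
flip i v = updateAt v i not

adj-flip : (i : Fin n) (v : Vertex n) → Adj v (flip i v)
adj-flip zero    (true ∷ v)  = cong suc (hamming-refl v)
adj-flip zero    (false ∷ v) = cong suc (hamming-refl v)
adj-flip (suc i) (true ∷ v)  = adj-flip i v
adj-flip (suc i) (false ∷ v) = adj-flip i v

flip-≢ : (i : Fin n) (v : Vertex n) → v ≢ flip i v
flip-≢ i v v≡ = 0≢1+n (trans (sym (hamming-refl v)) (subst (Adj v) (sym v≡) (adj-flip i v)))

flip₀≢flip₁ : (v : Vertex (suc (suc n))) → flip zero v ≢ flip (suc zero) v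
flip₀≢flip₁ (a ∷ b ∷ v) = not-¬ refl ∘ sym ∘ cong head

∃-avoiding : (u w : Vertex (suc (suc n))) → ∃[ c ] u ≢ c × w ≢ c
∃-avoiding u w with w ≟ flip zero u
... | no  w≢ = flip zero u , flip-≢ zero u , w≢
... | yes refl = flip (suc zero) u , flip-≢ (suc zero) u , flip₀≢flip₁ u

survives : Reach F u w → ¬ Deleted F u
survives (here u∉)     = u∉
survives (step u∉ _ _) = u∉

reach-trans : Reach F u v → Reach F v w → Reach F u w
reach-trans (here _)            v⇝w = v⇝w
reach-trans (step u∉ u~x x⇝v) v⇝w = step u∉ u~x (reach-trans x⇝v v⇝w)

reach-sym : Reach F u w → Reach F w u
reach-sym (here u∉)           = here u∉
reach-sym {u = u} (step {v = v} u∉ u~v v⇝w) =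
  reach-trans (reach-sym v⇝w) (step (survives v⇝w) (adj-sym {u = u} {v} u~v) (here u∉))

Near : Vertex n → Vertex n → Set
Near c v = hamming c v ≤ 1

star-near : (S : StarSub n r) → InStar S v → Near (center S) v
star-near S (inj₁ refl) = subst (_≤ 1) (sym (hamming-refl (center S))) z≤n
star-near S (inj₂ v∈S)  = subst (_≤ 1) (sym (lookup (adjacent S) v∈S)) (s≤s z≤n)

Outside : Vertex n → Vertex n → Vertex n → Set
Outside c₁ c₂ v = ¬ Near c₁ v × ¬ Near c₂ v

Avoids : Vertex n → Vertex n → Vertex n → Set
Avoids c₁ c₂ u = u ≢ c₁ × u ≢ c₂

Covers : List (StarSub n r) → Vertex n → Vertex n → Set
Covers F c₁ c₂ = ∀ {v} → Deleted F v → Near c₁ v ⊎ Near c₂ v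

OutsideNeighbour : Vertex n → Vertex n → Vertex n → Set
OutsideNeighbour c₁ c₂ u = ∃[ i ] Outside c₁ c₂ (flip i u)

Sink : Vertex n → Vertex n → Vertex n → Set
Sink c₁ c₂ t = ∀ v → Outside c₁ c₂ v → v ≢ t →
  ∃[ i ] Outside c₁ c₂ (flip i v) × hamming (flip i v) t < hamming v t

outside? : (c₁ c₂ : Vertex n) → Decidable (Outside c₁ c₂)
outside? c₁ c₂ v = ¬? (hamming c₁ v ≤? 1) ×-dec ¬? (hamming c₂ v ≤? 1)

outside-neighbour? : (c₁ c₂ : Vertex n) → Decidable (OutsideNeighbour c₁ c₂)
outside-neighbour? c₁ c₂ u = Fin.any? λ i → outside? c₁ c₂ (flip i u)

sink? : (c₁ c₂ : Vertex n) → Decidable (Sink c₁ c₂)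
sink? c₁ c₂ t = all? λ v → outside? c₁ c₂ v →-dec ¬? (v ≟ t) →-dec
  Fin.any? λ i → outside? c₁ c₂ (flip i v) ×-dec hamming (flip i v) t <? hamming v t

sink-Q₅ : (c₁ c₂ : Vertex 5) → ∃ (Sink c₁ c₂)
sink-Q₅ = toWitness {a? = all? λ c₁ → all? λ c₂ → any? (sink? c₁ c₂)} _

outside-neighbour-Q₅ : (c₁ c₂ u : Vertex 5) → Avoids c₁ c₂ u → OutsideNeighbour c₁ c₂ u
outside-neighbour-Q₅ c₁ c₂ u (u≢c₁ , u≢c₂) =
  toWitness {a? = all? λ c₁ → all? λ c₂ → all? λ u →
                   ¬? (u ≟ c₁) →-dec ¬? (u ≟ c₂) →-dec outside-neighbour? c₁ c₂ u}
            _ c₁ c₂ u u≢c₁ u≢c₂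

module _ {c₁ c₂ t : Vertex n} (cover : Covers F c₁ c₂) (sink : Sink c₁ c₂ t) where

  outside-survives : Outside c₁ c₂ v → ¬ Deleted F v
  outside-survives (far₁ , far₂) = [ far₁ , far₂ ] ∘ cover

  descend : ∀ v → Acc _<_ (hamming v t) → Outside c₁ c₂ v → Reach F v t
  descend v (acc rs) out with v ≟ t
  ... | yes refl = here (outside-survives out)
  ... | no v≢t with sink v out v≢t
  ...   | i , out′ , closer =
    step (outside-survives out) (adj-flip i v) (descend (flip i v) (rs closer) out′)

  reach-sink : ¬ Deleted F u → OutsideNeighbour c₁ c₂ u → Reach F u t
  reach-sink {u} u∉ (i , out) = step u∉ (adj-flip i u) (descend (flip i u) (<-wellFounded _) out)

reach-outside-two-balls : Covers F c₁ c₂ → ∃ (Sink c₁ c₂) →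
  (∀ x → Avoids c₁ c₂ x → OutsideNeighbour c₁ c₂ x) →
  ¬ Deleted F u → ¬ Deleted F w → Avoids c₁ c₂ u → Avoids c₁ c₂ w → Reach F u w
reach-outside-two-balls {F = F} {c₁ = c₁} {c₂} cover (t , sink) outside-neighbour u∉ w∉ u-avoids w-avoids =
  reach-trans (to-sink u∉ u-avoids) (reach-sym (to-sink w∉ w-avoids))
  where
    to-sink : ∀ {x} → ¬ Deleted F x → Avoids c₁ c₂ x → Reach F x t
    to-sink x∉ avoids = reach-sink {c₁ = c₁} {c₂} cover sink x∉ (outside-neighbour _ avoids)

covering-centres : (F : List (StarSub (suc (suc n)) r)) → length F < 3 → ¬ Deleted F u → ¬ Deleted F w →
  ∃₂ λ c₁ c₂ → Covers F c₁ c₂ × Avoids c₁ c₂ u × Avoids c₁ c₂ w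
covering-centres {u = u} {w} [] _ _ _ with ∃-avoiding u w
... | c , u≢c , w≢c = c , c , (λ ()) , (u≢c , u≢c) , (w≢c , w≢c)
covering-centres (S ∷ []) _ u∉ w∉ = center S , center S , cover , avoids u∉ , avoids w∉
  where
    cover : Covers (S ∷ []) (center S) (center S)
    cover (Any.here v∈S) = inj₁ (star-near S v∈S)

    avoids : ¬ Deleted (S ∷ []) v → Avoids (center S) (center S) v
    avoids v∉ = v∉ ∘ Any.here ∘ inj₁ , v∉ ∘ Any.here ∘ inj₁
covering-centres (S ∷ S′ ∷ []) _ u∉ w∉ = center S , center S′ , cover , avoids u∉ , avoids w∉
  where
    cover : Covers (S ∷ S′ ∷ []) (center S) (center S′)
    cover (Any.here v∈S)              = inj₁ (star-near S v∈S)
    cover (Any.there (Any.here v∈S′)) = inj₂ (star-near S′ v∈S′)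

    avoids : ¬ Deleted (S ∷ S′ ∷ []) v → Avoids (center S) (center S′) v
    avoids v∉ = v∉ ∘ Any.here ∘ inj₁ , v∉ ∘ Any.there ∘ Any.here ∘ inj₁
covering-centres (_ ∷ _ ∷ _ ∷ _) (s≤s (s≤s (s≤s ())))

lemma4p4 : (F : List (StarSub 5 5)) → length F < 3 → ¬ Disconnected F
lemma4p4 F |F|<3 (u , w , u∉ , w∉ , u↛w) with covering-centres F |F|<3 u∉ w∉
... | c₁ , c₂ , cover , u-avoids , w-avoids =
  u↛w (reach-outside-two-balls cover (sink-Q₅ c₁ c₂) (outside-neighbour-Q₅ c₁ c₂) u∉ w∉ u-avoids w-avoids)
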